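{- Let $\Gamma$ be a distance-regular graph with diameter $D\ge3$ and valency $k$, and assume $\Gamma$ is neither bipartite nor almost bipartite. Let $\theta,\theta'$ be real numbers other than $k$ that form a tight pair. Then $\theta\ne\theta'$.
   Context: $\Gamma$ is a finite, undirected, connected graph without loops or multiple edges, with path-length distance $\partial$ and diameter $D$. It is distance-regular: for all $0\le h,i,j\le D$ and all vertices $x,y$ with $\partial(x,y)=h$, the number $p^h_{ij}$ of vertices $z$ with $\partial(x,z)=i$, $\partial(y,z)=j$ depends only on $h,i,j$. Write $a_i=p^i_{1i}$, $b_i=p^i_{1,i+1}$ $(0\le i\le D-1)$, $c_i=p^i_{1,i-1}$ $(1\le i\le D)$, $c_0=0$, $b_D=0$, $k=b_0$. $\Gamma$ is bipartite if $a_i=0$ for $0\le i\le D$, almost bipartite if $a_D\ne0$ and $a_i=0$ for $0\le i\le D-1$. For $\theta\in\mathbb{R}$, the pseudo cosine sequence for $\theta$ is the sequence of reals $\sigma_0,\dots,\sigma_D$ with $\sigma_0=1$ and $c_i\sigma_{i-1}+a_i\sigma_i+b_i\sigma_{i+1}=\theta\sigma_i$ for $0\le i\le D-1$ (with $c_0\sigma_{ -1}=0$). Two pseudo cosine sequences $\sigma_i,\rho_i$ form a tight pair if $\sigma_0\rho_0,\dots,\sigma_D\rho_D$ is a pseudo cosine sequence; reals $\theta,\theta'$ form a tight pair if their pseudo cosine sequences do. -}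

module Defs where

open import Level using (0ℓ)
open import Data.Bool using (Bool; true; false; _∧_; _∨_; if_then_else_)
open import Data.Nat using (ℕ; zero; suc; _≤_; _<_; _∸_)
open import Data.Fin using (Fin)
open import Data.Fin.Properties using (_≟_)
open import Data.List using (List; filterᵇ; length; allFin)
open import Data.Bool.ListAction using (any)
open import Data.Sum using (_⊎_)
open import Data.Product using (Σ; _×_; ∃; ∃-syntax)
open import Relation.Binary.PropositionalEquality using (_≡_)
open import Relation.Nullary using (¬_)
open import Relation.Nullary.Decidable using (⌊_⌋)
open import Algebra.Bundles using (CommutativeRing)

-- The real numbers, axiomatised as a (Dedekind-)complete ordered field.
-- Any two such structures are isomorphic, so quantifying over all of
-- them is the same as speaking about ℝ.

record RealField : Set₁ where
  field
    commRing : CommutativeRing 0ℓ 0ℓ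
  open CommutativeRing commRing public
  field
    _≤ᴿ_        : Carrier → Carrier → Set
    ≤-refl      : ∀ {x y} → x ≈ y → x ≤ᴿ y
    ≤-trans     : ∀ {x y z} → x ≤ᴿ y → y ≤ᴿ z → x ≤ᴿ z
    ≤-antisym   : ∀ {x y} → x ≤ᴿ y → y ≤ᴿ x → x ≈ y
    ≤-total     : ∀ x y → (x ≤ᴿ y) ⊎ (y ≤ᴿ x)
    ≤-resp-≈    : ∀ {x x' y y'} → x ≈ x' → y ≈ y' → x ≤ᴿ y → x' ≤ᴿ y'
    +-mono-≤    : ∀ {x y} z → x ≤ᴿ y → (x + z) ≤ᴿ (y + z)
    *-nonneg    : ∀ {x y} → 0# ≤ᴿ x → 0# ≤ᴿ y → 0# ≤ᴿ (x * y)
    0≉1         : ¬ (0# ≈ 1#)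
    inverse     : ∀ x → ¬ (x ≈ 0#) → Σ Carrier (λ y → (x * y) ≈ 1#)
    sup         : (P : Carrier → Set) → Σ Carrier P →
                  Σ Carrier (λ u → ∀ x → P x → x ≤ᴿ u) →
                  Σ Carrier (λ s → (∀ x → P x → x ≤ᴿ s) ×
                                   (∀ u → (∀ x → P x → x ≤ᴿ u) → s ≤ᴿ u))

  fromℕ : ℕ → Carrier
  fromℕ zero    = 0#
  fromℕ (suc n) = 1# + fromℕ n

record Graph : Set where
  field
    n       : ℕ
    adj     : Fin n → Fin n → Bool
    sym     : ∀ x y → adj x y ≡ adj y x
    noLoops : ∀ x → adj x x ≡ false

module _ (Γ : Graph) where
  open Graph Γ

  reach : ℕ → Fin n → Fin n → Bool
  reach zero    x y = ⌊ x ≟ y ⌋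
  reach (suc m) x y = reach m x y ∨ any (λ z → reach m x z ∧ adj z y) (allFin n)

  Connected : Set
  Connected = ∀ x y → ∃[ m ] reach m x y ≡ true

-- least m < fuel with f m = true (returns fuel if none)
least : ℕ → (ℕ → Bool) → ℕ
least zero    f = zero
least (suc m) f = if f zero then zero else suc (least m (λ k → f (suc k)))

module _ (Γ : Graph) where
  open Graph Γ

  -- path-length distance (correct for connected graphs: distances are < n)
  dist : Fin n → Fin n → ℕ
  dist x y = least n (λ m → reach Γ m x y)

  countP : Fin n → Fin n → ℕ → ℕ → ℕ
  countP x y i j =
    length (filterᵇ (λ z → ⌊ dist x z Data.Nat.≟ i ⌋ ∧ ⌊ dist y z Data.Nat.≟ j ⌋) (allFin n))

  HasDiameter : ℕ → Set
  HasDiameter D = (∀ x y → dist x y ≤ D) × (∃[ x ] ∃[ y ] dist x y ≡ D)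

  -- p is a table of intersection numbers: p h i j = p^h_{ij}
  IntersectionNumbers : (ℕ → ℕ → ℕ → ℕ) → Set
  IntersectionNumbers p = ∀ x y h i j → dist x y ≡ h → countP x y i j ≡ p h i j

record DRG (D : ℕ) : Set where
  field
    graph     : Graph
    connected : Connected graph
    diameter  : HasDiameter graph D
    p         : ℕ → ℕ → ℕ → ℕ
    isDR      : IntersectionNumbers graph p

  a b c : ℕ → ℕ
  a i = p i 1 i
  b i = p i 1 (suc i)
  c zero    = 0
  c (suc i) = p (suc i) 1 i

  k : ℕ
  k = b 0

  Bipartite : Set
  Bipartite = ∀ i → i ≤ D → a i ≡ 0

  AlmostBipartite : Set
  AlmostBipartite = ¬ (a D ≡ 0) × (∀ i → i < D → a i ≡ 0)

module _ (R : RealField) {D : ℕ} (Γ : DRG D) where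
  open RealField R
  open DRG Γ

  -- σ is the pseudo cosine sequence for θ (only σ 0 … σ D matter)
  PseudoCosine : Carrier → (ℕ → Carrier) → Set
  PseudoCosine θ σ =
    (σ 0 ≈ 1#) ×
    (∀ i → i < D →
      (fromℕ (c i) * σ (i ∸ 1) + fromℕ (a i) * σ i + fromℕ (b i) * σ (suc i)) ≈ θ * σ i)

  TightPairSeq : (ℕ → Carrier) → (ℕ → Carrier) → Set
  TightPairSeq σ ρ = ∃[ η ] PseudoCosine η (λ i → σ i * ρ i)

  TightPair : Carrier → Carrier → Set
  TightPair θ θ' = ∀ σ ρ → PseudoCosine θ σ → PseudoCosine θ' ρ → TightPairSeq σ ρ

-- Suppose θ ≈ θ′ and let σ be the pseudo cosine sequence for θ (it exists because every b_i
-- with i < D is positive).  Tightness gives η such that σ_i² is the pseudo cosine sequence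
-- for η.  At i = 0 the two recurrences read k σ₁ = θ and k σ₁² = η, hence k η = θ².
-- As Γ is neither bipartite nor almost bipartite, a_i > 0 for some 0 < i < D.  Write
-- p, s, q for σ_{i-1}, σ_i, σ_{i+1}.  Lagrange's identity
-- (b + c)(c p² + b q²) − (c p + b q)² = b c (p − q)², combined with both recurrences at i
-- and with k η = θ², gives k b c (p − q)² + a (θ − k)² s² = 0.  Hence s = 0, since a > 0 and
-- θ ≠ k, and then the squared recurrence forces p = 0.  Running the recurrence backwards
-- (every c_j with 0 < j < D is positive) yields σ₀ = 0, contradicting σ₀ = 1.

module Submission where

open import Defs
open import Algebra.Bundles using (CommutativeRing)
open import Algebra.Solver.Ring.AlmostCommutativeRing
  using (fromCommutativeRing; _-Raw-AlmostCommutative⟶_)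
import Algebra.Solver.Ring
open import Data.Bool.Base using (Bool; true; false; T; if_then_else_; _∧_)
open import Data.Bool.Properties using (T-∧; T-∨; T-≡)
open import Data.Empty using (⊥-elim)
open import Data.Fin.Base using (Fin)
import Data.Fin.Properties as Fin
open import Data.Integer.Base as ℤ using (ℤ; +_; -[1+_]; _⊖_; _◃_; sign; ∣_∣)
import Data.Integer.Properties as ℤ
open import Data.List.Base using (List; []; _∷_; filterᵇ; length; allFin)
open import Data.List.Properties using (filter-some; filter-none; filter-all; length-tabulate)
open import Data.List.Membership.Propositional using (_∈_; lose)
open import Data.List.Membership.Propositional.Properties using (∈-allFin)
import Data.List.Relation.Unary.All as All
open import Data.List.Relation.Unary.Any using (here; there; satisfied)
open import Data.List.Relation.Unary.Any.Properties using (any⁺; any⁻)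
open import Data.Maybe.Base using (Maybe; just; nothing)
open import Data.Nat.Base as ℕ using (ℕ; zero; suc; _≤_; _<_; _∸_; z≤n; s≤s; _≤′_; ≤′-refl; ≤′-step)
import Data.Nat.Properties as ℕ
open import Algebra.Properties.CommutativeSemigroup ℕ.+-commutativeSemigroup
  using () renaming (interchange to +-interchange)
open import Data.Product.Base using (∃-syntax; _,_; proj₁; proj₂; _×_)
open import Data.Sign.Base as Sign using (Sign)
open import Data.Sum.Base using (_⊎_; inj₁; inj₂; [_,_])
open import Data.Unit.Base using (tt)
open import Function.Bundles using (module Equivalence)
open import Level using (Level)
open import Relation.Binary.PropositionalEquality as ≡ using (_≡_)
open import Relation.Nullary.Decidable
  using (⌊_⌋; Dec; yes; no; ¬?; T?; _→-dec_; fromWitness; toWitness; decidable-stable)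
open import Relation.Nullary.Negation using (¬_)

open Equivalence using (to; from)

-- Algebra.Solver.Ring needs coefficients whose arithmetic computes; ℤ embeds into every
-- commutative ring.
module IntegerCoefficients {c ℓ : Level} (R : CommutativeRing c ℓ) where
  open CommutativeRing R
  open import Algebra.Properties.Ring ring
  open import Algebra.Properties.Semiring.Mult semiring using (×-homo-+; ×1-homo-*)
    renaming (_×_ to _·_)
  open import Algebra.Properties.CommutativeSemigroup *-commutativeSemigroup as *-Props using ()
  open import Algebra.Properties.CommutativeSemigroup +-commutativeSemigroup as +-Props using ()
  open import Relation.Binary.Reasoning.Setoid setoid

  ⟦_⟧ : ℤ → Carrier
  ⟦ + n ⟧     = n · 1#
  ⟦ -[1+ n ] ⟧ = - (suc n · 1#)

  ⟦sign⟧ : Sign → Carrier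
  ⟦sign⟧ Sign.+ = 1#
  ⟦sign⟧ Sign.- = - 1#

  ⟦⟧-homo-neg : ∀ i → ⟦ ℤ.- i ⟧ ≈ - ⟦ i ⟧
  ⟦⟧-homo-neg (+ zero)  = sym -0#≈0#
  ⟦⟧-homo-neg (+ suc n) = refl
  ⟦⟧-homo-neg -[1+ n ]  = sym (-‿involutive _)

  ⟦⟧-homo-⊖ : ∀ m n → ⟦ m ⊖ n ⟧ ≈ m · 1# - n · 1#
  ⟦⟧-homo-⊖ m       zero    = sym (trans (+-congˡ -0#≈0#) (+-identityʳ _))
  ⟦⟧-homo-⊖ zero    (suc n) = sym (+-identityˡ _)
  ⟦⟧-homo-⊖ (suc m) (suc n) = begin
    ⟦ suc m ⊖ suc n ⟧            ≡⟨ ≡.cong ⟦_⟧ (ℤ.[1+m]⊖[1+n]≡m⊖n m n) ⟩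
    ⟦ m ⊖ n ⟧                    ≈⟨ ⟦⟧-homo-⊖ m n ⟩
    m · 1# - n · 1#              ≈⟨ [a+x]-[a+y]≈x-y 1# (m · 1#) (n · 1#) ⟨
    suc m · 1# - suc n · 1#      ∎
    where
    [a+x]-[a+y]≈x-y : ∀ a x y → (a + x) - (a + y) ≈ x - y
    [a+x]-[a+y]≈x-y a x y = begin
      (a + x) + - (a + y)   ≈⟨ +-congˡ (sym (-‿+-comm a y)) ⟩
      (a + x) + (- a + - y) ≈⟨ +-Props.interchange a x (- a) (- y) ⟩
      (a - a) + (x - y)     ≈⟨ +-congʳ (-‿inverseʳ a) ⟩
      0# + (x - y)          ≈⟨ +-identityˡ _ ⟩
      x - y                 ∎

  ⟦⟧-homo-+ : ∀ i j → ⟦ i ℤ.+ j ⟧ ≈ ⟦ i ⟧ + ⟦ j ⟧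
  ⟦⟧-homo-+ (+ m)     (+ n)     = ×-homo-+ 1# m n
  ⟦⟧-homo-+ (+ m)     -[1+ n ]  = ⟦⟧-homo-⊖ m (suc n)
  ⟦⟧-homo-+ -[1+ m ]  (+ n)     = trans (⟦⟧-homo-⊖ n (suc m)) (+-comm _ _)
  ⟦⟧-homo-+ -[1+ m ]  -[1+ n ]  = begin
    - (suc (suc (m ℕ.+ n)) · 1#)       ≡⟨ ≡.cong (λ k → - (suc k · 1#)) (ℕ.+-suc m n) ⟨
    - ((suc m ℕ.+ suc n) · 1#)         ≈⟨ -‿cong (×-homo-+ 1# (suc m) (suc n)) ⟩
    - (suc m · 1# + suc n · 1#)        ≈⟨ -‿+-comm _ _ ⟨
    - (suc m · 1#) + - (suc n · 1#)    ∎

  ⟦⟧-homo-◃ : ∀ s n → ⟦ s ◃ n ⟧ ≈ ⟦sign⟧ s * n · 1#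
  ⟦⟧-homo-◃ s      zero    = sym (zeroʳ _)
  ⟦⟧-homo-◃ Sign.+ (suc n) = sym (*-identityˡ _)
  ⟦⟧-homo-◃ Sign.- (suc n) = sym (-1*x≈-x _)

  ⟦sign⟧-homo-* : ∀ s t → ⟦sign⟧ (s Sign.* t) ≈ ⟦sign⟧ s * ⟦sign⟧ t
  ⟦sign⟧-homo-* Sign.- Sign.- = sym (trans (-1*x≈-x _) (-‿involutive _))
  ⟦sign⟧-homo-* Sign.- Sign.+ = sym (*-identityʳ _)
  ⟦sign⟧-homo-* Sign.+ t      = sym (*-identityˡ _)

  ⟦⟧-homo-* : ∀ i j → ⟦ i ℤ.* j ⟧ ≈ ⟦ i ⟧ * ⟦ j ⟧
  ⟦⟧-homo-* i j = begin
    ⟦ sign i Sign.* sign j ◃ ∣ i ∣ ℕ.* ∣ j ∣ ⟧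
      ≈⟨ ⟦⟧-homo-◃ (sign i Sign.* sign j) (∣ i ∣ ℕ.* ∣ j ∣) ⟩
    ⟦sign⟧ (sign i Sign.* sign j) * (∣ i ∣ ℕ.* ∣ j ∣) · 1#
      ≈⟨ *-cong (⟦sign⟧-homo-* (sign i) (sign j)) (×1-homo-* ∣ i ∣ ∣ j ∣) ⟩
    (⟦sign⟧ (sign i) * ⟦sign⟧ (sign j)) * (∣ i ∣ · 1# * ∣ j ∣ · 1#)
      ≈⟨ *-Props.interchange _ _ _ _ ⟩
    (⟦sign⟧ (sign i) * ∣ i ∣ · 1#) * (⟦sign⟧ (sign j) * ∣ j ∣ · 1#)
      ≈⟨ *-cong (decompose i) (decompose j) ⟨
    ⟦ i ⟧ * ⟦ j ⟧
      ∎
    where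
    decompose : ∀ i → ⟦ i ⟧ ≈ ⟦sign⟧ (sign i) * ∣ i ∣ · 1#
    decompose i = trans (reflexive (≡.cong ⟦_⟧ (≡.sym (ℤ.◃-inverse i)))) (⟦⟧-homo-◃ (sign i) ∣ i ∣)

  homomorphism : ℤ.+-*-rawRing -Raw-AlmostCommutative⟶ fromCommutativeRing R
  homomorphism = record
    { ⟦_⟧    = ⟦_⟧
    ; +-homo = ⟦⟧-homo-+
    ; *-homo = ⟦⟧-homo-*
    ; -‿homo = ⟦⟧-homo-neg
    ; 0-homo = refl
    ; 1-homo = +-identityʳ 1#
    }

  ⟦⟧-equal? : ∀ i j → Maybe (⟦ i ⟧ ≈ ⟦ j ⟧)
  ⟦⟧-equal? i j with i ℤ.≟ j
  ... | yes ≡.refl = just refl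
  ... | no _       = nothing

  open Algebra.Solver.Ring ℤ.+-*-rawRing (fromCommutativeRing R) homomorphism ⟦⟧-equal? public
    using (solve; con; _:+_; _:*_; _:-_; :-_; _:=_)


module OrderedFieldProperties (ℝ : RealField) where
  open RealField ℝ
  open IntegerCoefficients commRing using (solve; con; _:+_; _:*_; _:-_; :-_; _:=_)
  open import Algebra.Properties.Group +-group using (x∙y⁻¹≈ε⇒x≈y; x≈y⇒x∙y⁻¹≈ε)
  open import Algebra.Properties.CommutativeSemigroup *-commutativeSemigroup using (xy∙z≈y∙xz; x∙yz≈y∙xz)
  open import Relation.Binary.Reasoning.Setoid setoid

  x≤x+y : ∀ x {y} → 0# ≤ᴿ y → x ≤ᴿ (x + y)
  x≤x+y x {y} 0≤y = ≤-resp-≈ (+-identityˡ x) (+-comm y x) (+-mono-≤ x 0≤y)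

  +-nonneg : ∀ {x y} → 0# ≤ᴿ x → 0# ≤ᴿ y → 0# ≤ᴿ (x + y)
  +-nonneg 0≤x 0≤y = ≤-trans 0≤x (x≤x+y _ 0≤y)

  nonneg-x+y≈0⇒x≈0 : ∀ {x y} → 0# ≤ᴿ x → 0# ≤ᴿ y → x + y ≈ 0# → x ≈ 0#
  nonneg-x+y≈0⇒x≈0 0≤x 0≤y x+y≈0 = ≤-antisym (≤-resp-≈ refl x+y≈0 (x≤x+y _ 0≤y)) 0≤x

  nonneg-x+y≈0⇒y≈0 : ∀ {x y} → 0# ≤ᴿ x → 0# ≤ᴿ y → x + y ≈ 0# → y ≈ 0#
  nonneg-x+y≈0⇒y≈0 0≤x 0≤y x+y≈0 = nonneg-x+y≈0⇒x≈0 0≤y 0≤x (trans (+-comm _ _) x+y≈0)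

  square-nonneg : ∀ x → 0# ≤ᴿ (x * x)
  square-nonneg x with ≤-total 0# x
  ... | inj₁ 0≤x = *-nonneg 0≤x 0≤x
  ... | inj₂ x≤0 = ≤-resp-≈ refl (solve 1 (λ x → :- x :* :- x := x :* x) refl x) (*-nonneg 0≤-x 0≤-x)
    where
    0≤-x : 0# ≤ᴿ (- x)
    0≤-x = ≤-resp-≈ (-‿inverseʳ x) (+-identityˡ (- x)) (+-mono-≤ (- x) x≤0)

  0≤1 : 0# ≤ᴿ 1#
  0≤1 = ≤-resp-≈ refl (*-identityˡ 1#) (square-nonneg 1#)

  fromℕ-nonneg : ∀ n → 0# ≤ᴿ fromℕ n
  fromℕ-nonneg zero    = ≤-refl refl
  fromℕ-nonneg (suc n) = +-nonneg 0≤1 (fromℕ-nonneg n)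

  fromℕ-+ : ∀ m n → fromℕ (m ℕ.+ n) ≈ fromℕ m + fromℕ n
  fromℕ-+ zero    n = sym (+-identityˡ _)
  fromℕ-+ (suc m) n = trans (+-congˡ (fromℕ-+ m n)) (sym (+-assoc _ _ _))

  fromℕ-suc≉0 : ∀ n → ¬ fromℕ (suc n) ≈ 0#
  fromℕ-suc≉0 n 1+n≈0 = 0≉1 (sym (nonneg-x+y≈0⇒x≈0 0≤1 (fromℕ-nonneg n) 1+n≈0))

  fromℕ≉0 : ∀ {n} → 0 < n → ¬ fromℕ n ≈ 0#
  fromℕ≉0 {suc n} _ = fromℕ-suc≉0 n

  x≉0⇒xy≈0⇒y≈0 : ∀ {x y} → ¬ x ≈ 0# → x * y ≈ 0# → y ≈ 0#
  x≉0⇒xy≈0⇒y≈0 {x} {y} x≉0 xy≈0 with inverse x x≉0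
  ... | x⁻¹ , xx⁻¹≈1 = begin
    y                ≈⟨ *-identityˡ y ⟨
    1# * y           ≈⟨ *-congʳ xx⁻¹≈1 ⟨
    (x * x⁻¹) * y    ≈⟨ xy∙z≈y∙xz x x⁻¹ y ⟩
    x⁻¹ * (x * y)    ≈⟨ *-congˡ xy≈0 ⟩
    x⁻¹ * 0#         ≈⟨ zeroʳ x⁻¹ ⟩
    0#               ∎

  *-≉0 : ∀ {x y} → ¬ x ≈ 0# → ¬ y ≈ 0# → ¬ x * y ≈ 0#
  *-≉0 x≉0 y≉0 xy≈0 = y≉0 (x≉0⇒xy≈0⇒y≈0 x≉0 xy≈0)

  -- Equality in ℝ is not decidable, so a vanishing square only refutes x ≉ 0.
  x*x≈0⇒¬¬x≈0 : ∀ {x} → x * x ≈ 0# → ¬ ¬ x ≈ 0#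
  x*x≈0⇒¬¬x≈0 xx≈0 x≉0 = *-≉0 x≉0 x≉0 xx≈0

  -- The junk value fromℕ⁻¹ 0 = 0# is never used: only nonzero naturals get inverted.
  fromℕ⁻¹ : ℕ → Carrier
  fromℕ⁻¹ zero    = 0#
  fromℕ⁻¹ (suc n) = proj₁ (inverse (fromℕ (suc n)) (fromℕ-suc≉0 n))

  fromℕ*fromℕ⁻¹≈1 : ∀ {n} → 0 < n → fromℕ n * fromℕ⁻¹ n ≈ 1#
  fromℕ*fromℕ⁻¹≈1 {suc n} _ = proj₂ (inverse (fromℕ (suc n)) (fromℕ-suc≉0 n))

  three-term-solve : ∀ {a b c t x y ι} → b * ι ≈ 1# →
    c * x + a * y + b * ((t * y - a * y - c * x) * ι) ≈ t * y
  three-term-solve {a} {b} {c} {t} {x} {y} {ι} bι≈1 = begin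
    c * x + a * y + b * (W * ι)  ≈⟨ +-congˡ (x∙yz≈y∙xz b W ι) ⟩
    c * x + a * y + W * (b * ι)  ≈⟨ +-congˡ (trans (*-congˡ bι≈1) (*-identityʳ W)) ⟩
    c * x + a * y + W            ≈⟨ solve 5 (λ a c t x y → c :* x :+ a :* y :+ (t :* y :- a :* y :- c :* x)
                                                       := t :* y) refl a c t x y ⟩
    t * y                        ∎
    where
    W = t * y - a * y - c * x

  three-term-initial : ∀ {a b t x y z} → a ≈ 0# → y ≈ 1# → 0# * x + a * y + b * z ≈ t * y → b * z ≈ t
  three-term-initial {a} {b} {t} {x} {y} {z} a≈0 y≈1 rec = begin
    b * z
      ≈⟨ solve 3 (λ x y bz → con (+ 0) :* x :+ con (+ 0) :* y :+ bz := bz) refl x y (b * z) ⟨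
    0# * x + 0# * y + b * z     ≈⟨ +-congʳ (+-congˡ (*-congʳ a≈0)) ⟨
    0# * x + a * y + b * z      ≈⟨ rec ⟩
    t * y                       ≈⟨ trans (*-congˡ y≈1) (*-identityʳ t) ⟩
    t                           ∎

  three-term-vanishing : ∀ {a b c t x y z} → y ≈ 0# → z ≈ 0# → c * x + a * y + b * z ≈ t * y → c * x ≈ 0#
  three-term-vanishing {a} {b} {c} {t} {x} {y} {z} y≈0 z≈0 rec = begin
    c * x
      ≈⟨ solve 3 (λ cx a b → cx :+ a :* con (+ 0) :+ b :* con (+ 0) := cx) refl (c * x) a b ⟨
    c * x + a * 0# + b * 0#     ≈⟨ +-cong (+-congˡ (*-congˡ y≈0)) (*-congˡ z≈0) ⟨
    c * x + a * y + b * z       ≈⟨ rec ⟩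
    t * y                       ≈⟨ trans (*-congˡ y≈0) (zeroʳ t) ⟩
    0#                          ∎

  x≈0⇒x*x≈0 : ∀ {x} → x ≈ 0# → x * x ≈ 0#
  x≈0⇒x*x≈0 {x} x≈0 = trans (*-congˡ x≈0) (zeroʳ x)

  -- Lagrange's identity (b + c)(c p² + b q²) − (c p + b q)² = b c (p − q)², rewritten through
  -- the defects of the linear and the squared recurrence and of (a + b + c) η = θ².
  lagrange-certificate : ∀ a b c p s q θ η →
    (a + b + c) * b * c * ((p - q) * (p - q))
      + a * (((θ - (a + b + c)) * s) * ((θ - (a + b + c)) * s))
    ≈ (a + b + c) * (b + c) * ((c * (p * p) + a * (s * s) + b * (q * q)) - η * (s * s))
      - (a + b + c) * (c * p + b * q + (θ - a) * s) * ((c * p + a * s + b * q) - θ * s)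
      + (b + c) * (s * s) * ((a + b + c) * η - θ * θ)
  lagrange-certificate = solve 8 (λ a b c p s q θ η →
    (a :+ b :+ c) :* b :* c :* ((p :- q) :* (p :- q))
      :+ a :* (((θ :- (a :+ b :+ c)) :* s) :* ((θ :- (a :+ b :+ c)) :* s))
    := (a :+ b :+ c) :* (b :+ c) :* ((c :* (p :* p) :+ a :* (s :* s) :+ b :* (q :* q)) :- η :* (s :* s))
      :- (a :+ b :+ c) :* (c :* p :+ b :* q :+ (θ :- a) :* s) :* ((c :* p :+ a :* s :+ b :* q) :- θ :* s)
      :+ (b :+ c) :* (s :* s) :* ((a :+ b :+ c) :* η :- θ :* θ)) refl

  tight-step⇒¬¬[s≈0×p≈0] : ∀ {a b c θ η p s q} →
    0# ≤ᴿ a → 0# ≤ᴿ b → 0# ≤ᴿ c → ¬ a ≈ 0# → ¬ c ≈ 0# → ¬ θ ≈ a + b + c →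
    c * p + a * s + b * q ≈ θ * s →
    c * (p * p) + a * (s * s) + b * (q * q) ≈ η * (s * s) →
    (a + b + c) * η ≈ θ * θ →
    ¬ ¬ (s ≈ 0# × p ≈ 0#)
  tight-step⇒¬¬[s≈0×p≈0] {a} {b} {c} {θ} {η} {p} {s} {q} 0≤a 0≤b 0≤c a≉0 c≉0 θ≉k linear squared kη≈θ²
    ¬zeros = ¬¬s≈0 (λ s≈0 → ¬¬p≈0 s≈0 (λ p≈0 → ¬zeros (s≈0 , p≈0)))
    where
    k μ : Carrier
    k = a + b + c
    μ = θ - k

    gap≈0 : k * b * c * ((p - q) * (p - q)) + a * ((μ * s) * (μ * s)) ≈ 0#
    gap≈0 = begin
      k * b * c * ((p - q) * (p - q)) + a * ((μ * s) * (μ * s))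
        ≈⟨ lagrange-certificate a b c p s q θ η ⟩
      k * (b + c) * _ - k * (c * p + b * q + (θ - a) * s) * _ + (b + c) * (s * s) * _
        ≈⟨ +-cong (+-cong (*-congˡ (x≈y⇒x∙y⁻¹≈ε squared)) (-‿cong (*-congˡ (x≈y⇒x∙y⁻¹≈ε linear))))
                  (*-congˡ (x≈y⇒x∙y⁻¹≈ε kη≈θ²)) ⟩
      k * (b + c) * 0# - k * (c * p + b * q + (θ - a) * s) * 0# + (b + c) * (s * s) * 0#
        ≈⟨ solve 3 (λ u v w → u :* con (+ 0) :- v :* con (+ 0) :+ w :* con (+ 0) := con (+ 0)) refl _ _ _ ⟩
      0# ∎

    ¬¬s≈0 : ¬ ¬ s ≈ 0#
    ¬¬s≈0 s≉0 = x*x≈0⇒¬¬x≈0 μs*μs≈0 (*-≉0 μ≉0 s≉0)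
      where
      μs*μs≈0 : (μ * s) * (μ * s) ≈ 0#
      μs*μs≈0 = x≉0⇒xy≈0⇒y≈0 a≉0 (nonneg-x+y≈0⇒y≈0
        (*-nonneg (*-nonneg (*-nonneg (+-nonneg (+-nonneg 0≤a 0≤b) 0≤c) 0≤b) 0≤c) (square-nonneg _))
        (*-nonneg 0≤a (square-nonneg _)) gap≈0)
      μ≉0 : ¬ μ ≈ 0#
      μ≉0 μ≈0 = θ≉k (x∙y⁻¹≈ε⇒x≈y θ k μ≈0)

    ¬¬p≈0 : s ≈ 0# → ¬ ¬ p ≈ 0#
    ¬¬p≈0 s≈0 = x*x≈0⇒¬¬x≈0 (x≉0⇒xy≈0⇒y≈0 c≉0
      (nonneg-x+y≈0⇒x≈0 (*-nonneg 0≤c (square-nonneg p)) (*-nonneg 0≤b (square-nonneg q)) cp²+bq²≈0))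
      where
      cp²+bq²≈0 : c * (p * p) + b * (q * q) ≈ 0#
      cp²+bq²≈0 = begin
        c * (p * p) + b * (q * q)
          ≈⟨ solve 7 (λ a b c p s q η → c :* (p :* p) :+ b :* (q :* q)
                := ((c :* (p :* p) :+ a :* (s :* s) :+ b :* (q :* q)) :- η :* (s :* s)) :+ (η :- a) :* (s :* s))
              refl a b c p s q η ⟩
        ((c * (p * p) + a * (s * s) + b * (q * q)) - η * (s * s)) + (η - a) * (s * s)
          ≈⟨ +-cong (x≈y⇒x∙y⁻¹≈ε squared) (*-congˡ (x≈0⇒x*x≈0 s≈0)) ⟩
        0# + (η - a) * 0#
          ≈⟨ solve 1 (λ x → con (+ 0) :+ x :* con (+ 0) := con (+ 0)) refl (η - a) ⟩
        0# ∎

indicator : Bool → ℕ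
indicator b = if b then 1 else 0

count : ∀ {A : Set} → (A → Bool) → List A → ℕ
count f xs = length (filterᵇ f xs)

module _ {A : Set} where

  count-∷ : ∀ (f : A → Bool) x xs → count f (x ∷ xs) ≡ indicator (f x) ℕ.+ count f xs
  count-∷ f x xs with f x
  ... | true  = ≡.refl
  ... | false = ≡.refl

  count-positive : ∀ {f : A → Bool} {y xs} → y ∈ xs → T (f y) → 0 < count f xs
  count-positive y∈xs fy = filter-some _ (lose y∈xs fy)

  count-zero : ∀ {f : A → Bool} → (∀ z → ¬ T (f z)) → ∀ xs → count f xs ≡ 0
  count-zero ¬f xs = ≡.cong length (filter-none _ (All.universal ¬f xs))

  count-const-true : ∀ (xs : List A) → count (λ _ → true) xs ≡ length xs
  count-const-true xs = ≡.cong length (filter-all _ (All.universal (λ _ → tt) xs))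

  count-mono : ∀ {f g : A → Bool} → (∀ z → T (f z) → T (g z)) → ∀ xs → count f xs ≤ count g xs
  count-mono f⇒g [] = z≤n
  count-mono {f} {g} f⇒g (x ∷ xs) with f x | g x | f⇒g x
  ... | true  | true  | _   = s≤s (count-mono f⇒g xs)
  ... | true  | false | f⇒g = ⊥-elim (f⇒g tt)
  ... | false | true  | _   = ℕ.m≤n⇒m≤1+n (count-mono f⇒g xs)
  ... | false | false | _   = count-mono f⇒g xs

  count-< : ∀ {f g : A → Bool} → (∀ z → T (f z) → T (g z)) →
            ∀ {y xs} → y ∈ xs → ¬ T (f y) → T (g y) → count f xs < count g xs
  count-< {f} {g} f⇒g {xs = x ∷ xs} (here ≡.refl) ¬fx gx with f x | g x
  ... | true  | _     = ⊥-elim (¬fx tt)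
  ... | false | true  = s≤s (count-mono f⇒g xs)
  count-< {f} {g} f⇒g {xs = x ∷ xs} (there y∈xs) ¬fy gy with f x | g x | f⇒g x
  ... | true  | true  | _   = s≤s (count-< f⇒g y∈xs ¬fy gy)
  ... | true  | false | f⇒g = ⊥-elim (f⇒g tt)
  ... | false | true  | _   = ℕ.m≤n⇒m≤1+n (count-< f⇒g y∈xs ¬fy gy)
  ... | false | false | _   = count-< f⇒g y∈xs ¬fy gy

  count-sum₃ : ∀ {f g h i : A → Bool} →
               (∀ z → indicator (g z) ℕ.+ indicator (h z) ℕ.+ indicator (i z) ≡ indicator (f z)) →
               ∀ xs → count g xs ℕ.+ count h xs ℕ.+ count i xs ≡ count f xs
  count-sum₃ split [] = ≡.refl
  count-sum₃ {f} {g} {h} {i} split (x ∷ xs) = begin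
    count g (x ∷ xs) ℕ.+ count h (x ∷ xs) ℕ.+ count i (x ∷ xs)
      ≡⟨ ≡.cong₂ ℕ._+_ (≡.cong₂ ℕ._+_ (count-∷ g x xs) (count-∷ h x xs)) (count-∷ i x xs) ⟩
    (G ℕ.+ count g xs) ℕ.+ (H ℕ.+ count h xs) ℕ.+ (I ℕ.+ count i xs)
      ≡⟨ ≡.cong (ℕ._+ (I ℕ.+ count i xs)) (+-interchange G (count g xs) H (count h xs)) ⟩
    (G ℕ.+ H) ℕ.+ (count g xs ℕ.+ count h xs) ℕ.+ (I ℕ.+ count i xs)
      ≡⟨ +-interchange (G ℕ.+ H) _ I (count i xs) ⟩
    (G ℕ.+ H ℕ.+ I) ℕ.+ (count g xs ℕ.+ count h xs ℕ.+ count i xs)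
      ≡⟨ ≡.cong₂ ℕ._+_ (split x) (count-sum₃ split xs) ⟩
    indicator (f x) ℕ.+ count f xs
      ≡⟨ count-∷ f x xs ⟨
    count f (x ∷ xs) ∎
    where
    open ≡.≡-Reasoning
    G = indicator (g x)
    H = indicator (h x)
    I = indicator (i x)

both-≟ : ∀ {m i n j} → m ≡ i → n ≡ j → T (⌊ m ℕ.≟ i ⌋ ∧ ⌊ n ℕ.≟ j ⌋)
both-≟ {m} {i} {n} {j} m≡i n≡j = from (T-∧ {⌊ m ℕ.≟ i ⌋}) (fromWitness m≡i , fromWitness n≡j)

both-≟⁻ : ∀ {m i n j} → T (⌊ m ℕ.≟ i ⌋ ∧ ⌊ n ℕ.≟ j ⌋) → m ≡ i × n ≡ j
both-≟⁻ {m} {i} {n} {j} t with to (T-∧ {⌊ m ℕ.≟ i ⌋}) t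
... | m≟i , n≟j = toWitness m≟i , toWitness n≟j

⌊suc≟suc⌋ : ∀ m n → ⌊ suc m ℕ.≟ suc n ⌋ ≡ ⌊ m ℕ.≟ n ⌋
⌊suc≟suc⌋ m n with m ℕ.≟ n | suc m ℕ.≟ suc n
... | yes _   | yes _     = ≡.refl
... | no _    | no _      = ≡.refl
... | yes m≡n | no 1+m≢1+n = ⊥-elim (1+m≢1+n (≡.cong suc m≡n))
... | no m≢n  | yes 1+m≡1+n = ⊥-elim (m≢n (ℕ.suc-injective 1+m≡1+n))

one-of-three : ∀ j v → j ≤ v → v ≤ 2 ℕ.+ j →
  indicator ⌊ v ℕ.≟ suc j ⌋ ℕ.+ indicator ⌊ v ℕ.≟ 2 ℕ.+ j ⌋ ℕ.+ indicator ⌊ v ℕ.≟ j ⌋ ≡ 1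
one-of-three zero    0                   _         _                 = ≡.refl
one-of-three zero    1                   _         _                 = ≡.refl
one-of-three zero    2                   _         _                 = ≡.refl
one-of-three zero    (suc (suc (suc v))) _         (s≤s (s≤s ()))
one-of-three (suc j) (suc v)             (s≤s j≤v) (s≤s v≤2+j)
  rewrite ⌊suc≟suc⌋ v (suc j) | ⌊suc≟suc⌋ v (2 ℕ.+ j) | ⌊suc≟suc⌋ v j = one-of-three j v j≤v v≤2+j

least-≤ : ∀ N (f : ℕ → Bool) {m} → T (f m) → least N f ≤ m
least-≤ zero    f fm = z≤n
least-≤ (suc N) f {m} fm with f zero in f0
... | true = z≤n
least-≤ (suc N) f {zero}  fm | false rewrite f0 = ⊥-elim fm
least-≤ (suc N) f {suc m} fm | false = s≤s (least-≤ N (λ k → f (suc k)) fm)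

least-true : ∀ N (f : ℕ → Bool) → least N f < N → T (f (least N f))
least-true (suc N) f lt with f zero in f0
... | true  rewrite f0 = tt
... | false = least-true N (λ k → f (suc k)) (ℕ.≤-pred lt)

least-minimal : ∀ N (f : ℕ → Bool) {m} → m < least N f → ¬ T (f m)
least-minimal (suc N) f {m} lt with f zero in f0
least-minimal (suc N) f {zero}  lt | false rewrite f0 = λ ()
least-minimal (suc N) f {suc m} lt | false = least-minimal N (λ k → f (suc k)) (ℕ.≤-pred lt)

module Walks (Γ : Graph) where
  open Graph Γ

  Reach : ℕ → Fin n → Fin n → Set
  Reach m x y = T (reach Γ m x y)

  Adj : Fin n → Fin n → Set
  Adj x y = T (adj x y)

  reach-refl : ∀ x → Reach 0 x x
  reach-refl x = fromWitness ≡.refl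

  reach-0⇒≡ : ∀ {x y} → Reach 0 x y → x ≡ y
  reach-0⇒≡ = toWitness

  reach-suc : ∀ {m x y} → Reach m x y → Reach (suc m) x y
  reach-suc r = from T-∨ (inj₁ r)

  reach-mono : ∀ {m m′ x y} → m ≤ m′ → Reach m x y → Reach m′ x y
  reach-mono {x = x} {y} m≤m′ = go (ℕ.≤⇒≤′ m≤m′)
    where
    go : ∀ {m m′} → m ≤′ m′ → Reach m x y → Reach m′ x y
    go ≤′-refl             r = r
    go (≤′-step {m′} m≤m′) r = reach-suc {m′} {x} {y} (go m≤m′ r)

  reach-snoc : ∀ {m x z y} → Reach m x z → Adj z y → Reach (suc m) x y
  reach-snoc {z = z} r a = from T-∨ (inj₂ (any⁺ _ (lose (∈-allFin z) (from T-∧ (r , a)))))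

  reach-suc⁻ : ∀ {m x y} → Reach (suc m) x y → Reach m x y ⊎ ∃[ z ] (Reach m x z × Adj z y)
  reach-suc⁻ {m} {x} {y} r with to T-∨ r
  ... | inj₁ r′ = inj₁ r′
  ... | inj₂ r′ with satisfied (any⁻ _ (allFin n) r′)
  ...   | z , rz∧a = inj₂ (z , to T-∧ rz∧a)

  reach-cons : ∀ {m x z y} → Adj x z → Reach m z y → Reach (suc m) x y
  reach-cons {zero} {x} a r with reach-0⇒≡ r
  ... | ≡.refl = reach-snoc {0} {x} (reach-refl x) a
  reach-cons {suc m} {x} {z} {y} a r with reach-suc⁻ {m} {z} {y} r
  ... | inj₁ r′           = reach-suc {suc m} {x} {y} (reach-cons {m} {x} {z} {y} a r′)
  ... | inj₂ (w , r′ , a′) = reach-snoc {suc m} {x} {w} (reach-cons {m} {x} {z} {w} a r′) a′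

  adj-sym : ∀ {x y} → Adj x y → Adj y x
  adj-sym {x} {y} = ≡.subst T (sym x y)

  reach-sym : ∀ {m x y} → Reach m x y → Reach m y x
  reach-sym {zero} r with reach-0⇒≡ r
  ... | ≡.refl = r
  reach-sym {suc m} {x} {y} r with reach-suc⁻ {m} {x} {y} r
  ... | inj₁ r′ = reach-suc {m} {y} {x} (reach-sym {m} {x} {y} r′)
  ... | inj₂ (z , r′ , a) = reach-cons {m} {y} {z} {x} (adj-sym a) (reach-sym {m} {x} {z} r′)

  -- The sets of vertices within m steps of x grow strictly until they stabilise, and they
  -- have at most n elements.
  module Saturation (connected : Connected Γ) (x : Fin n) where

    reached : ℕ → ℕ
    reached m = count (reach Γ m x) (allFin n)

    Stable : ℕ → Set
    Stable m = ∀ y → Reach (suc m) x y → Reach m x y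

    stable? : ∀ m → Dec (Stable m)
    stable? m = Fin.all? (λ y → T? (reach Γ (suc m) x y) →-dec T? (reach Γ m x y))

    stable-forever : ∀ {m} → Stable m → ∀ j {y} → Reach (j ℕ.+ m) x y → Reach m x y
    stable-forever st zero    r = r
    stable-forever {m} st (suc j) {y} r with reach-suc⁻ {j ℕ.+ m} {x} {y} r
    ... | inj₁ r′           = stable-forever st j r′
    ... | inj₂ (z , r′ , a) = st y (reach-snoc {m} {x} {z} (stable-forever st j r′) a)

    unstable⇒grows : ∀ m → ¬ Stable m → reached m < reached (suc m)
    unstable⇒grows m ¬st
      with Fin.¬∀⟶∃¬ n _ (λ y → T? (reach Γ (suc m) x y) →-dec T? (reach Γ m x y)) ¬st
    ... | y , ¬[r₁⇒r₀] = count-< (λ z → reach-suc {m} {x} {z}) (∈-allFin y)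
      (λ r₀ → ¬[r₁⇒r₀] (λ _ → r₀))
      (decidable-stable (T? _) (λ ¬r₁ → ¬[r₁⇒r₀] (λ r₁ → ⊥-elim (¬r₁ r₁))))

    grows-or-stabilises : ∀ m → suc m ≤ reached m ⊎ ∃[ m′ ] (m′ ≤ m × Stable m′)
    grows-or-stabilises zero = inj₁ (count-positive (∈-allFin x) (reach-refl x))
    grows-or-stabilises (suc m) with grows-or-stabilises m
    ... | inj₂ (m′ , m′≤m , st) = inj₂ (m′ , ℕ.m≤n⇒m≤1+n m′≤m , st)
    ... | inj₁ m<reached with stable? m
    ...   | yes st  = inj₂ (m , ℕ.n≤1+n m , st)
    ...   | no ¬st = inj₁ (ℕ.≤-trans (s≤s m<reached) (unstable⇒grows m ¬st))

    reach-saturates : ∀ y → Reach (ℕ.pred n) x y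
    reach-saturates y with grows-or-stabilises (ℕ.pred n)
    ... | inj₂ (m′ , m′≤ , st) with connected x y
    ...   | M , rM = reach-mono m′≤ (stable-forever st M (reach-mono (ℕ.m≤m+n M m′) (from T-≡ rM)))
    reach-saturates y | inj₁ n≤reached = decidable-stable (T? _) λ ¬r → ℕ.<-irrefl ≡.refl (begin-strict
      n                                       ≡⟨ ℕ.suc-pred n {{Fin.nonZeroIndex x}} ⟨
      suc (ℕ.pred n)                          ≤⟨ n≤reached ⟩
      reached (ℕ.pred n)                      <⟨ count-< (λ _ _ → tt) (∈-allFin y) ¬r tt ⟩
      count (λ _ → true) (allFin n)           ≡⟨ count-const-true (allFin n) ⟩
      length (allFin n)                       ≡⟨ length-tabulate (λ z → z) ⟩
      n                                       ∎)
      where open ℕ.≤-Reasoning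

  module Distance (connected : Connected Γ) where
    open Saturation connected using (reach-saturates)

    dist-≤ : ∀ {m x y} → Reach m x y → dist Γ x y ≤ m
    dist-≤ {x = x} {y} = least-≤ n (λ m → reach Γ m x y)

    dist-minimal : ∀ {m x y} → m < dist Γ x y → ¬ Reach m x y
    dist-minimal {x = x} {y} = least-minimal n (λ m → reach Γ m x y)

    dist<n : ∀ x y → dist Γ x y < n
    dist<n x y = ℕ.≤-trans (s≤s (dist-≤ (reach-saturates x y)))
                           (ℕ.≤-reflexive (ℕ.suc-pred n {{Fin.nonZeroIndex x}}))

    dist-reach : ∀ x y → Reach (dist Γ x y) x y
    dist-reach x y = least-true n (λ m → reach Γ m x y) (dist<n x y)

    dist-sym : ∀ x y → dist Γ x y ≡ dist Γ y x
    dist-sym x y = ℕ.≤-antisym (dist-≤ (reach-sym {dist Γ y x} {y} {x} (dist-reach y x)))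
                               (dist-≤ (reach-sym {dist Γ x y} {x} {y} (dist-reach x y)))

    dist-self : ∀ x → dist Γ x x ≡ 0
    dist-self x = ℕ.n≤0⇒n≡0 (dist-≤ (reach-refl x))

    dist≡0⇒≡ : ∀ {x y} → dist Γ x y ≡ 0 → x ≡ y
    dist≡0⇒≡ {x} {y} d≡0 = reach-0⇒≡ (≡.subst (λ m → Reach m x y) d≡0 (dist-reach x y))

    dist-adj : ∀ u {v w} → Adj v w → dist Γ u w ≤ suc (dist Γ u v)
    dist-adj u {v} a = dist-≤ (reach-snoc {dist Γ u v} {u} {v} (dist-reach u v) a)

    dist-pred : ∀ {u v m} → dist Γ u v ≡ suc m → ∃[ w ] (dist Γ u w ≡ m × Adj w v)
    dist-pred {u} {v} {m} d≡1+m
      with reach-suc⁻ {m} {u} {v} (≡.subst (λ k → Reach k u v) d≡1+m (dist-reach u v))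
    ... | inj₁ r = ⊥-elim (dist-minimal (ℕ.≤-reflexive (≡.sym d≡1+m)) r)
    ... | inj₂ (w , r , a) = w , ℕ.≤-antisym (dist-≤ r) (ℕ.≤-pred (begin
      suc m              ≡⟨ d≡1+m ⟨
      dist Γ u v         ≤⟨ dist-adj u a ⟩
      suc (dist Γ u w)   ∎)) , a
      where open ℕ.≤-Reasoning

    adj⇒dist≡1 : ∀ {u v} → Adj u v → dist Γ u v ≡ 1
    adj⇒dist≡1 {u} {v} a with dist Γ u v in d | dist-adj u {u} {v} a
    ... | zero  | _ = ⊥-elim (≡.subst T (noLoops u) (≡.subst (λ w → Adj u w) (≡.sym (dist≡0⇒≡ d)) a))
    ... | suc zero | _ = ≡.refl
    ... | suc (suc _) | d≤1 rewrite dist-self u with () ← ℕ.≤-pred d≤1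

    dist≡1⇒adj : ∀ {u v} → dist Γ u v ≡ 1 → Adj u v
    dist≡1⇒adj d≡1 with dist-pred d≡1
    ... | w , d≡0 , a rewrite dist≡0⇒≡ d≡0 = a

module IntersectionNumbers {D : ℕ} (Γ : DRG D) where
  open DRG Γ
  open Graph graph using (n)
  open Walks graph using (Adj; adj-sym)
  open Walks.Distance graph connected

  d : Fin n → Fin n → ℕ
  d = dist graph

  countP-positive : ∀ {x y z i j} → d x z ≡ i → d y z ≡ j → 0 < countP graph x y i j
  countP-positive {x} {y} {z} {i} {j} dxz dyz =
    count-positive {f = λ z → ⌊ d x z ℕ.≟ i ⌋ ∧ ⌊ d y z ℕ.≟ j ⌋} (∈-allFin z) (both-≟ dxz dyz)

  pair-at-distance : ∀ {h} → h ≤ D → ∃[ x ] ∃[ y ] d x y ≡ h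
  pair-at-distance h≤D with proj₂ diameter
  ... | x , y , dxy≡D = x , descend (ℕ.≤⇒≤′ h≤D) dxy≡D
    where
    descend : ∀ {h m y} → h ≤′ m → d x y ≡ m → ∃[ y′ ] d x y′ ≡ h
    descend ≤′-refl       dxy≡m = _ , dxy≡m
    descend (≤′-step h≤m) dxy≡m = descend h≤m (proj₁ (proj₂ (dist-pred dxy≡m)))

  a₀≡0 : a 0 ≡ 0
  a₀≡0 with pair-at-distance z≤n
  ... | x , _ = ≡.trans (≡.sym (isDR x x 0 1 0 (dist-self x))) (count-zero ¬[d≡1∧d≡0] (allFin n))
    where
    ¬[d≡1∧d≡0] : ∀ z → ¬ T (⌊ d x z ℕ.≟ 1 ⌋ ∧ ⌊ d x z ℕ.≟ 0 ⌋)
    ¬[d≡1∧d≡0] z both with both-≟⁻ {d x z} both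
    ... | d≡1 , d≡0 with () ← ≡.trans (≡.sym d≡1) d≡0

  b-positive : ∀ {i} → i < D → 0 < b i
  b-positive {i} i<D with pair-at-distance i<D
  ... | x , y , dxy with dist-pred dxy
  ...   | w , dxw , w~y = ≡.subst (0 <_) (isDR w x i 1 (suc i) (≡.trans (dist-sym w x) dxw))
                            (countP-positive (adj⇒dist≡1 w~y) dxy)

  c-positive : ∀ {i} → 0 < i → i ≤ D → 0 < c i
  c-positive {suc i} _ i≤D with pair-at-distance i≤D
  ... | x , y , dxy with dist-pred dxy
  ...   | w , dxw , w~y = ≡.subst (0 <_) (isDR y x (suc i) 1 i (≡.trans (dist-sym y x) dxy))
                            (countP-positive (adj⇒dist≡1 (adj-sym w~y)) dxw)

  a+b+c≡k : ∀ {i} → 0 < i → i ≤ D → a i ℕ.+ b i ℕ.+ c i ≡ k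
  a+b+c≡k {suc j} _ i≤D with pair-at-distance i≤D
  ... | x , y , dxy = begin
    a (suc j) ℕ.+ b (suc j) ℕ.+ c (suc j)
      ≡⟨ ≡.cong₂ ℕ._+_ (≡.cong₂ ℕ._+_ (count≡ (suc j)) (count≡ (2 ℕ.+ j))) (count≡ j) ⟨
    countP graph x y 1 (suc j) ℕ.+ countP graph x y 1 (2 ℕ.+ j) ℕ.+ countP graph x y 1 j
      ≡⟨ count-sum₃ neighbours-split (allFin n) ⟩
    countP graph x x 1 1
      ≡⟨ isDR x x 0 1 1 (dist-self x) ⟩
    k ∎
    where
    open ≡.≡-Reasoning
    count≡ : ∀ l → countP graph x y 1 l ≡ p (suc j) 1 l
    count≡ l = isDR x y (suc j) 1 l dxy

    neighbours-split : ∀ z →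
      indicator (⌊ d x z ℕ.≟ 1 ⌋ ∧ ⌊ d y z ℕ.≟ suc j ⌋)
        ℕ.+ indicator (⌊ d x z ℕ.≟ 1 ⌋ ∧ ⌊ d y z ℕ.≟ 2 ℕ.+ j ⌋)
        ℕ.+ indicator (⌊ d x z ℕ.≟ 1 ⌋ ∧ ⌊ d y z ℕ.≟ j ⌋)
      ≡ indicator (⌊ d x z ℕ.≟ 1 ⌋ ∧ ⌊ d x z ℕ.≟ 1 ⌋)
    neighbours-split z with d x z ℕ.≟ 1
    ... | no _    = ≡.refl
    ... | yes dxz = one-of-three j (d y z)
      (ℕ.≤-pred (≡.subst (_≤ suc (d y z)) dyx (dist-adj y (adj-sym x~z))))
      (≡.subst (λ m → d y z ≤ suc m) dyx (dist-adj y x~z))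
      where
      x~z : Adj x z
      x~z = dist≡1⇒adj dxz
      dyx : d y x ≡ suc j
      dyx = ≡.trans (dist-sym y x) dxy

  bipartite-or-almostBipartite : (∀ i → i < D → a i ≡ 0) → Bipartite ⊎ AlmostBipartite
  bipartite-or-almostBipartite below with a D ℕ.≟ 0
  ... | yes a_D≡0 = inj₁ (λ i i≤D → [ below i , (λ { ≡.refl → a_D≡0 }) ] (ℕ.m≤n⇒m<n∨m≡n i≤D))
  ... | no a_D≢0  = inj₂ (a_D≢0 , below)

  nonzero-a-below-diameter : ¬ Bipartite → ¬ AlmostBipartite → ∃[ i ] (0 < i × i < D × 0 < a i)
  nonzero-a-below-diameter ¬bip ¬abip with ℕ.anyUpTo? (λ i → ¬? (a i ℕ.≟ 0)) D
  ... | yes (zero  , _   , a₀≢0) = ⊥-elim (a₀≢0 a₀≡0)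
  ... | yes (suc i , i<D , aᵢ≢0) = suc i , s≤s z≤n , i<D , ℕ.n≢0⇒n>0 aᵢ≢0
  ... | no ∄ = ⊥-elim ([ ¬bip , ¬abip ] (bipartite-or-almostBipartite below))
    where
    below : ∀ i → i < D → a i ≡ 0
    below i i<D = decidable-stable (a i ℕ.≟ 0) (λ aᵢ≢0 → ∄ (i , i<D , aᵢ≢0))

module PseudoCosines (ℝ : RealField) {D : ℕ} (Γ : DRG D) where
  open RealField ℝ
  open DRG Γ
  open OrderedFieldProperties ℝ
  open IntersectionNumbers Γ
  open IntegerCoefficients commRing using (solve; _:*_; _:=_)

  PseudoCosine-resp-≈ : ∀ {θ θ′ σ} → θ ≈ θ′ → PseudoCosine ℝ Γ θ σ → PseudoCosine ℝ Γ θ′ σ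
  PseudoCosine-resp-≈ θ≈θ′ (σ₀≈1 , rec) = σ₀≈1 , λ i i<D → trans (rec i i<D) (*-congʳ θ≈θ′)

  module _ (θ : Carrier) where

    next : ℕ → Carrier → Carrier → Carrier
    next i σᵢ₋₁ σᵢ = (θ * σᵢ - fromℕ (a i) * σᵢ - fromℕ (c i) * σᵢ₋₁) * fromℕ⁻¹ (b i)

    cosine : ℕ → Carrier
    cosine zero          = 1#
    -- At i = 0 PseudoCosine reads σ (0 ∸ 1) = σ 0, so σ₀ = 1 also stands in for σ₋₁.
    cosine (suc zero)    = next 0 1# 1#
    cosine (suc (suc i)) = next (suc i) (cosine i) (cosine (suc i))

    cosine-isPseudoCosine : PseudoCosine ℝ Γ θ cosine
    cosine-isPseudoCosine = refl , recurrence
      where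
      recurrence : ∀ i → i < D →
        fromℕ (c i) * cosine (i ∸ 1) + fromℕ (a i) * cosine i + fromℕ (b i) * cosine (suc i) ≈ θ * cosine i
      recurrence zero    0<D   = three-term-solve (fromℕ*fromℕ⁻¹≈1 (b-positive 0<D))
      recurrence (suc i) 1+i<D = three-term-solve (fromℕ*fromℕ⁻¹≈1 (b-positive 1+i<D))

  pseudoCosine-descent : ∀ {θ σ} → PseudoCosine ℝ Γ θ σ →
    ∀ i → suc i < D → σ i ≈ 0# → σ (suc i) ≈ 0# → σ 0 ≈ 0#
  pseudoCosine-descent pc zero    _      σ₀≈0 _      = σ₀≈0
  pseudoCosine-descent pc (suc i) 2+i<D σ₁₊ᵢ≈0 σ₂₊ᵢ≈0 = pseudoCosine-descent pc i 1+i<D σᵢ≈0 σ₁₊ᵢ≈0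
    where
    1+i<D = ℕ.<-trans (ℕ.n<1+n _) 2+i<D
    σᵢ≈0 = x≉0⇒xy≈0⇒y≈0 (fromℕ≉0 (c-positive (s≤s z≤n) (ℕ.<⇒≤ 1+i<D)))
                         (three-term-vanishing σ₁₊ᵢ≈0 σ₂₊ᵢ≈0 (proj₂ pc (suc i) 1+i<D))

  tight⇒kη≈θ² : ∀ {θ η σ} → 0 < D → PseudoCosine ℝ Γ θ σ → PseudoCosine ℝ Γ η (λ i → σ i * σ i) →
               fromℕ k * η ≈ θ * θ
  tight⇒kη≈θ² {θ} {η} {σ} 0<D (σ₀≈1 , σ-rec) (_ , σ²-rec) = begin
    K * η                   ≈⟨ *-congˡ Kσ₁²≈η ⟨
    K * (K * (σ 1 * σ 1))   ≈⟨ solve 2 (λ K s → K :* (K :* (s :* s)) := (K :* s) :* (K :* s)) refl K (σ 1) ⟩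
    (K * σ 1) * (K * σ 1)   ≈⟨ *-cong Kσ₁≈θ Kσ₁≈θ ⟩
    θ * θ                   ∎
    where
    open import Relation.Binary.Reasoning.Setoid setoid
    K = fromℕ k
    a₀≈0 : fromℕ (a 0) ≈ 0#
    a₀≈0 = reflexive (≡.cong fromℕ a₀≡0)
    Kσ₁≈θ : K * σ 1 ≈ θ
    Kσ₁≈θ = three-term-initial a₀≈0 σ₀≈1 (σ-rec 0 0<D)
    Kσ₁²≈η : K * (σ 1 * σ 1) ≈ η
    Kσ₁²≈η = three-term-initial a₀≈0 (trans (*-cong σ₀≈1 σ₀≈1) (*-identityˡ 1#)) (σ²-rec 0 0<D)

  tight-pair-distinct : ∀ {θ θ′ j} → suc j < D → 0 < a (suc j) →
                        ¬ θ ≈ fromℕ k → TightPair ℝ Γ θ θ′ → ¬ θ ≈ θ′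
  tight-pair-distinct {θ} {θ′} {j} i<D aᵢ>0 θ≉k tight θ≈θ′ =
    tight-step⇒¬¬[s≈0×p≈0] (fromℕ-nonneg (a i)) (fromℕ-nonneg (b i)) (fromℕ-nonneg (c i))
      (fromℕ≉0 aᵢ>0) (fromℕ≉0 (c-positive (s≤s z≤n) (ℕ.<⇒≤ i<D)))
      (λ θ≈abc → θ≉k (trans θ≈abc (sym k≈abc)))
      (proj₂ σ-pc i i<D) (proj₂ σ²-pc i i<D)
      (trans (*-congʳ (sym k≈abc)) (tight⇒kη≈θ² 0<D σ-pc σ²-pc))
      (λ (σᵢ≈0 , σⱼ≈0) → 0≉1 (sym (pseudoCosine-descent σ-pc j i<D σⱼ≈0 σᵢ≈0)))
    where
    i = suc j
    0<D = ℕ.<-trans (s≤s z≤n) i<D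
    σ = cosine θ
    σ-pc = cosine-isPseudoCosine θ
    σ²-pc = proj₂ (tight σ σ σ-pc (PseudoCosine-resp-≈ θ≈θ′ σ-pc))
    k≈abc : fromℕ k ≈ fromℕ (a i) + fromℕ (b i) + fromℕ (c i)
    k≈abc = trans (reflexive (≡.cong fromℕ (≡.sym (a+b+c≡k (s≤s z≤n) (ℕ.<⇒≤ i<D)))))
                  (trans (fromℕ-+ (a i ℕ.+ b i) (c i)) (+-congʳ (fromℕ-+ (a i) (b i))))

lemma6p1 : (R : RealField) (D : ℕ) (Γ : DRG D) → 3 ≤ D →
           ¬ DRG.Bipartite Γ → ¬ DRG.AlmostBipartite Γ →
           (θ θ' : RealField.Carrier R) →
           ¬ RealField._≈_ R θ (RealField.fromℕ R (DRG.k Γ)) →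
           ¬ RealField._≈_ R θ' (RealField.fromℕ R (DRG.k Γ)) →
           TightPair R Γ θ θ' →
           ¬ RealField._≈_ R θ θ'
lemma6p1 ℝ D Γ _ ¬bip ¬abip θ θ′ θ≉k _ tight
  with IntersectionNumbers.nonzero-a-below-diameter Γ ¬bip ¬abip
... | suc j , _ , i<D , aᵢ>0 = PseudoCosines.tight-pair-distinct ℝ Γ i<D aᵢ>0 θ≉k tight
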